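{- Let $G$ be a graph with twin decomposition $\Pi$ and let $S$ be an inclusion-minimal twin-cover of $G$. Then for every part $P\in\Pi$, either $P\subseteq S$ or $P\cap S=\emptyset$.
   Context: All graphs are finite, simple and undirected. Two vertices $u,v$ of $G$ are (true) twins if $N_G[u]=N_G[v]$ (closed neighborhoods). A twin decomposition of $G$ is a partition $\Pi$ of $V(G)$ such that two vertices are in the same part if and only if they are twins. A set $X\subseteq V(G)$ is a twin-cover of $G$ if for every edge $\{u,v\}\in E(G)$, $u\in X$ or $v\in X$ or $u$ and $v$ are twins; it is minimal if no proper subset is a twin-cover. -}

module Defs where

open import Data.Nat using (ℕ)
open import Data.Fin using (Fin)
open import Data.Fin.Subset using (Subset; _∈_; _∉_; _⊆_; _⊂_)
open import Data.Product using (_×_; ∃)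
open import Data.Sum using (_⊎_)
open import Data.Empty using (⊥)
open import Relation.Nullary using (¬_)
open import Relation.Binary.PropositionalEquality using (_≡_)
open import Function.Bundles using (_⇔_)

record Graph (n : ℕ) : Set₁ where
  field
    Adj     : Fin n → Fin n → Set
    sym     : ∀ {u v} → Adj u v → Adj v u
    irrefl  : ∀ {u} → ¬ Adj u u
open Graph public

InClosedNbhd : ∀ {n} → Graph n → Fin n → Fin n → Set
InClosedNbhd G u w = (w ≡ u) ⊎ Adj G u w

Twins : ∀ {n} → Graph n → Fin n → Fin n → Set
Twins G u v = ∀ w → InClosedNbhd G u w ⇔ InClosedNbhd G v w

-- A twin decomposition, represented by a labelling of vertices by part
-- labels (Fin k): two vertices are in the same part iff they are twins.
-- The parts of Π are the nonempty fibres of the labelling.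
IsTwinDecomposition : ∀ {n k} → Graph n → (Fin n → Fin k) → Set
IsTwinDecomposition G Π = ∀ u v → (Π u ≡ Π v) ⇔ Twins G u v

IsTwinCover : ∀ {n} → Graph n → Subset n → Set
IsTwinCover G X = ∀ u v → Adj G u v → (u ∈ X) ⊎ (v ∈ X) ⊎ Twins G u v

IsMinimalTwinCover : ∀ {n} → Graph n → Subset n → Set
IsMinimalTwinCover G X = IsTwinCover G X × (∀ Y → Y ⊂ X → ¬ IsTwinCover G Y)

module Submission where

-- Removing u from a twin-cover S keeps it a twin-cover as soon as u has a twin
-- w outside S: an edge ux with x ∉ S is also an edge wx (or x = w), and that
-- edge is covered only because x is a twin of w, hence of u. So in a minimal
-- twin-cover no vertex of S has a twin outside S, i.e. every twin class lies
-- entirely inside or entirely outside S.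

open import Defs
open import Data.Fin using (Fin; _≟_)
open import Data.Fin.Subset using (Subset; _∈_; _∉_; _-_)
open import Data.Fin.Subset.Properties using (_∈?_; x∈p∧x≢y⇒x∈p-y; x∈p⇒p-x⊂p)
open import Data.Product using (∃; _,_)
open import Data.Sum using (_⊎_; inj₁; inj₂)
open import Relation.Nullary using (Dec; yes; no; contradiction)
open import Relation.Binary.PropositionalEquality as ≡ using (_≡_; refl)
open import Function.Bundles using (Equivalence)
import Function.Properties.Equivalence as ⇔

module _ {n} (G : Graph n) where

  twins-sym : ∀ {u v} → Twins G u v → Twins G v u
  twins-sym t w = ⇔.sym (t w)

  twins-trans : ∀ {u v x} → Twins G u v → Twins G v x → Twins G u x
  twins-trans t s w = ⇔.trans (t w) (s w)

  module _ {S : Subset n} (cover : IsTwinCover G S)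
           {u w : Fin n} (w∉S : w ∉ S) (twin : Twins G u w) where

    neighbour-covered : ∀ {x} → Adj G u x → x ∈ S - u ⊎ Twins G u x
    neighbour-covered {x} ux with x ∈? S
    ... | yes x∈S = inj₁ (x∈p∧x≢y⇒x∈p-y x∈S λ { refl → irrefl G ux })
    ... | no x∉S with Equivalence.to (twin x) (inj₂ ux)
    ...   | inj₁ refl = inj₂ twin
    ...   | inj₂ wx with cover w x wx
    ...     | inj₁ w∈S = contradiction w∈S w∉S
    ...     | inj₂ (inj₁ x∈S) = contradiction x∈S x∉S
    ...     | inj₂ (inj₂ twin′) = inj₂ (twins-trans twin twin′)

    twinCover-remove : IsTwinCover G (S - u)
    twinCover-remove a b ab with a ≟ u | b ≟ u
    ... | yes refl | _ with neighbour-covered ab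
    ...   | inj₁ b∈S-u = inj₂ (inj₁ b∈S-u)
    ...   | inj₂ t = inj₂ (inj₂ t)
    twinCover-remove a b ab | no a≢u | yes refl with neighbour-covered (sym G ab)
    ...   | inj₁ a∈S-u = inj₁ a∈S-u
    ...   | inj₂ t = inj₂ (inj₂ (twins-sym t))
    twinCover-remove a b ab | no a≢u | no b≢u with cover a b ab
    ...   | inj₁ a∈S = inj₁ (x∈p∧x≢y⇒x∈p-y a∈S a≢u)
    ...   | inj₂ (inj₁ b∈S) = inj₂ (inj₁ (x∈p∧x≢y⇒x∈p-y b∈S b≢u))
    ...   | inj₂ (inj₂ t) = inj₂ (inj₂ t)

  minimalTwinCover-twin-closed : ∀ {S u w} → IsMinimalTwinCover G S
                               → Twins G u w → u ∈ S → w ∈ S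
  minimalTwinCover-twin-closed {S} {u} {w} (cover , minimal) twin u∈S with w ∈? S
  ... | yes w∈S = w∈S
  ... | no w∉S = contradiction (twinCover-remove cover w∉S twin)
                               (minimal (S - u) (x∈p⇒p-x⊂p u∈S))

twinDecomposition-twins : ∀ {n k} (G : Graph n) (Π : Fin n → Fin k) → IsTwinDecomposition G Π
                        → ∀ {x y p} → Π x ≡ p → Π y ≡ p → Twins G x y
twinDecomposition-twins G Π decomposition {x} {y} Πx≡p Πy≡p =
  Equivalence.to (decomposition x y) (≡.trans Πx≡p (≡.sym Πy≡p))

lemma8 : ∀ {n k} (G : Graph n) (Π : Fin n → Fin k) (S : Subset n)
         → IsTwinDecomposition G Π
         → IsMinimalTwinCover G S
         → ∀ (p : Fin k) → ∃ (λ v → Π v ≡ p)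
         → (∀ u → Π u ≡ p → u ∈ S) ⊎ (∀ u → Π u ≡ p → u ∉ S)
lemma8 G Π S decomposition minimal p (v , Πv≡p) = dichotomy (v ∈? S)
  where
  part-closed : ∀ {x y} → Π x ≡ p → Π y ≡ p → x ∈ S → y ∈ S
  part-closed Πx≡p Πy≡p =
    minimalTwinCover-twin-closed G minimal (twinDecomposition-twins G Π decomposition Πx≡p Πy≡p)

  dichotomy : Dec (v ∈ S) → (∀ u → Π u ≡ p → u ∈ S) ⊎ (∀ u → Π u ≡ p → u ∉ S)
  dichotomy (yes v∈S) = inj₁ λ u Πu≡p → part-closed Πv≡p Πu≡p v∈S
  dichotomy (no v∉S) = inj₂ λ u Πu≡p u∈S → v∉S (part-closed Πu≡p Πv≡p u∈S)
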